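{- Let $r \ge 2$ and $n \ge 1$ be integers. Then \[ \mathrm{rank}\, H_{2^r-1}\big(\mathrm{VR}(Q_n; r)\big) \;\ge\; 2^{\,n-(r+1)}\binom{n}{r+1}. \]
   Context: $Q_n$ denotes the set $\{0,1\}^n$ equipped with the $\ell^1$ (Hamming) metric $d(a,b)=\sum_{i=1}^n |a_i-b_i|$. For a metric space $X$ and $r\ge 0$, the Vietoris--Rips complex $\mathrm{VR}(X;r)$ is the simplicial complex with vertex set $X$ whose simplices are the finite subsets $\sigma\subseteq X$ with $\max_{a,b\in\sigma} d(a,b)\le r$. Homology is taken with coefficients in $\mathbb{Z}$ or in a field; the rank of a finitely generated abelian group is the cardinality of a maximal linearly independent subset. -}

module Defs where

open import Data.Nat as ℕ using (ℕ; zero; suc; _≤_; _∸_; _^_)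
open import Data.Integer as ℤ using (ℤ; 0ℤ; 1ℤ; -_; _*_; _+_)
open import Data.Bool using (Bool; true; false; if_then_else_)
import Data.Bool as B
open import Data.Fin using (Fin; toℕ)
open import Data.Vec as V using (Vec; []; _∷_; lookup; removeAt; allFin)
import Data.Vec.Properties as VP
open import Data.List as L using (List; []; _∷_; concatMap)
open import Data.List.Relation.Unary.All using (All)
open import Data.Product using (_×_; _,_; Σ; ∃)
open import Data.Sum using (_⊎_)
open import Data.Empty using (⊥)
open import Data.Unit using (⊤)
open import Relation.Binary.PropositionalEquality using (_≡_)
open import Relation.Nullary.Decidable using (does)

Vertex : ℕ → Set
Vertex n = Vec Bool n

hamming : ∀ {n} → Vertex n → Vertex n → ℕ
hamming []       []       = 0
hamming (x ∷ xs) (y ∷ ys) = (if does (x B.≟ y) then 0 else 1) ℕ.+ hamming xs ys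

-- a fixed strict total order (lexicographic, false < true) on vertices,
-- used to orient simplices
_<ᴸ_ : ∀ {n} → Vertex n → Vertex n → Set
[]       <ᴸ []       = ⊥
(x ∷ xs) <ᴸ (y ∷ ys) = (x ≡ false × y ≡ true) ⊎ (x ≡ y × xs <ᴸ ys)

Increasing : ∀ {n m} → Vec (Vertex n) m → Set
Increasing []               = ⊤
Increasing (x ∷ [])         = ⊤
Increasing (x ∷ y ∷ xs)     = x <ᴸ y × Increasing (y ∷ xs)

-- Oriented simplices of VR(Q_n ; r): an (m)-simplex is a strictly
-- increasing list of m+1 vertices of pairwise distance ≤ r.

IsVRSimplex : ∀ (n r : ℕ) {m} → Vec (Vertex n) (suc m) → Set
IsVRSimplex n r σ =
  Increasing σ × (∀ i j → hamming (lookup σ i) (lookup σ j) ≤ r)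

-- Simplicial chains with ℤ coefficients, as formal sums (lists of
-- coefficient/simplex pairs); two chains are equal iff all coefficients
-- agree.

Chain : ℕ → ℕ → Set
Chain n m = List (ℤ × Vec (Vertex n) (suc m))

IsVRChain : ∀ (n r : ℕ) {m} → Chain n m → Set
IsVRChain n r c = All (λ p → IsVRSimplex n r (Data.Product.proj₂ p)) c

coeff : ∀ {n m} → Chain n m → Vec (Vertex n) (suc m) → ℤ
coeff []             τ = 0ℤ
coeff ((a , σ) ∷ c) τ =
  (if does (VP.≡-dec (VP.≡-dec B._≟_) σ τ) then a else 0ℤ) + coeff c τ

sign : ℕ → ℤ
sign zero          = 1ℤ
sign (suc zero)    = - 1ℤ
sign (suc (suc i)) = sign i

∂ : ∀ {n m} → Chain n (suc m) → Chain n m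
∂ = concatMap (λ { (a , σ) →
      V.toList (V.map (λ i → (sign (toℕ i) * a , removeAt σ i)) (allFin _)) })

scale : ∀ {n m} → ℤ → Chain n m → Chain n m
scale b = L.map (λ { (a , σ) → (b * a , σ) })

linComb : ∀ {n m k} → (Fin k → ℤ) → (Fin k → Chain n m) → Chain n m
linComb c z = concatMap (λ i → scale (c i) (z i)) (L.allFin _)

IsCycle : ∀ (n r : ℕ) {m} → Chain n (suc m) → Set
IsCycle n r z = IsVRChain n r z × (∀ τ → coeff (∂ z) τ ≡ 0ℤ)

IsBoundary : ∀ (n r : ℕ) {m} → Chain n m → Set
IsBoundary n r {m} c =
  Σ (Chain n (suc m)) λ w → IsVRChain n r w × (∀ τ → coeff (∂ w) τ ≡ coeff c τ)

-- rank H_{m+1}(VR(Q_n; r); ℤ) ≥ N : there are N homology classes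
-- [z₁],…,[z_N] that are linearly independent in H_{m+1}, i.e.
-- Σ cᵢ[zᵢ] = 0 implies all cᵢ = 0.
RankHomologyAtLeast : (n r m N : ℕ) → Set
RankHomologyAtLeast n r m N =
  Σ (Fin N → Chain n (suc m)) λ z →
    (∀ i → IsCycle n r (z i)) ×
    (∀ (c : Fin N → ℤ) → IsBoundary n r (linComb c z) → ∀ i → c i ≡ 0ℤ)

{-# OPTIONS --safe #-}
module Submission where

-- Fix an (r+1)-dimensional subcube of Q_n. Its 2^r antipodal pairs are at distance r + 1 and all other
-- pairs of its vertices at distance ≤ r, so the join of the 2^r zero-spheres {a, b} (the boundary of a
-- cross-polytope, a (2^r − 1)-sphere) lies in VR(Q_n; r) and is a cycle. Picking from each pair the
-- vertex whose first three subcube coordinates have even parity gives a facet F of this sphere that is a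
-- maximal simplex of VR(Q_n; r): a vertex within distance r of all of F lies in the subcube, and then in
-- F, since otherwise its antipode would be in F. A boundary has coefficient 0 on a maximal simplex and F
-- lies in no other subcube, so the cycles of the 2^(n−r−1) C(n, r+1) subcubes are independent in homology.

open import Defs
open import Data.Nat as ℕ using (ℕ; zero; suc; _≤_; _<_; _∸_; _^_; z≤n; s≤s)
import Data.Nat.Properties as ℕP
open import Algebra.Properties.CommutativeSemigroup ℕP.+-commutativeSemigroup using (x∙yz≈y∙xz)
open import Data.Integer as ℤ using (ℤ; 0ℤ; 1ℤ; -1ℤ; -_; _*_; _+_; _-_)
import Data.Integer.Properties as ℤP
open import Data.Integer.Tactic.RingSolver using (solve-∀)
open import Data.Nat.Combinatorics using (_C_; k>n⇒nCk≡0; nCk+nC[k+1]≡[n+1]C[k+1])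
open import Data.Bool as B using (Bool; true; false; if_then_else_; not; _∧_; _xor_)
import Data.Bool.Properties as BP
open import Data.Fin as F using (Fin; toℕ)
import Data.Fin.Properties as FP
open import Data.Vec as V using (Vec; []; _∷_; lookup; removeAt; _∷ʳ_; tabulate)
import Data.Vec.Properties as VP
import Data.Vec.Relation.Unary.All.Properties as VAllP
open import Data.List as L using (List; []; _∷_; _++_)
import Data.List.Properties as LP
open import Data.List.Relation.Unary.All as All using (All; []; _∷_)
import Data.List.Relation.Unary.All.Properties as AllP
open import Data.List.Relation.Unary.Any using (here; there)
open import Data.List.Membership.Propositional using (_∈_)
open import Data.List.Membership.Propositional.Properties using (∈-map⁺; ∈-map⁻; ∈-++⁺ˡ; ∈-++⁺ʳ; ∈-++⁻; ∈-lookup)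
open import Data.List.Relation.Unary.AllPairs as AllPairs using (AllPairs; []; _∷_)
import Data.List.Relation.Unary.AllPairs.Properties as AllPairsP
open import Data.List.Relation.Unary.Unique.Propositional using (Unique)
import Data.List.Relation.Unary.Unique.Propositional.Properties as UniqueP
open import Data.List.Relation.Binary.Disjoint.Propositional using (Disjoint)
open import Data.Product using (_×_; _,_; ∃; proj₁; proj₂; map₂)
open import Data.Sum using (_⊎_; inj₁; inj₂)
open import Data.Empty using (⊥-elim)
open import Data.Unit using (⊤; tt)
open import Relation.Binary.PropositionalEquality
open import Relation.Binary using (DecidableEquality)
open import Relation.Nullary using (¬_; yes; no; does)
open import Relation.Nullary.Decidable using (dec-true; dec-false)
open import Function using (_∘_)

last′ : ∀ {A : Set} {k} → Vec A (suc k) → A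
last′ (x ∷ [])     = x
last′ (x ∷ y ∷ ys) = last′ (y ∷ ys)

init′ : ∀ {A : Set} {k} → Vec A (suc k) → Vec A k
init′ (x ∷ [])     = []
init′ (x ∷ y ∷ ys) = x ∷ init′ (y ∷ ys)

init′-∷ʳ-last′ : ∀ {A : Set} {k} (xs : Vec A (suc k)) → xs ≡ init′ xs ∷ʳ last′ xs
init′-∷ʳ-last′ (x ∷ [])     = refl
init′-∷ʳ-last′ (x ∷ y ∷ ys) = cong (x ∷_) (init′-∷ʳ-last′ (y ∷ ys))

last′-lookup : ∀ {A : Set} {k} (xs : Vec A (suc k)) → ∃ λ i → last′ xs ≡ lookup xs i
last′-lookup (x ∷ [])     = F.zero , refl
last′-lookup (x ∷ y ∷ ys) with last′-lookup (y ∷ ys)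
... | i , e = F.suc i , e

lookup-∷ʳ⁻ : ∀ {A : Set} {k} (xs : Vec A k) b i →
  lookup (xs ∷ʳ b) i ≡ b ⊎ ∃ λ j → lookup (xs ∷ʳ b) i ≡ lookup xs j
lookup-∷ʳ⁻ []       b F.zero    = inj₁ refl
lookup-∷ʳ⁻ (x ∷ xs) b F.zero    = inj₂ (F.zero , refl)
lookup-∷ʳ⁻ (x ∷ xs) b (F.suc i) with lookup-∷ʳ⁻ xs b i
... | inj₁ e       = inj₁ e
... | inj₂ (j , e) = inj₂ (F.suc j , e)

lookup-∷ʳ-last : ∀ {A : Set} {k} (xs : Vec A k) b → ∃ λ i → lookup (xs ∷ʳ b) i ≡ b
lookup-∷ʳ-last []       b = F.zero , refl
lookup-∷ʳ-last (x ∷ xs) b with lookup-∷ʳ-last xs b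
... | i , e = F.suc i , e

lookup-∷ʳ⁺ : ∀ {A : Set} {k} (xs : Vec A k) b j → ∃ λ i → lookup (xs ∷ʳ b) i ≡ lookup xs j
lookup-∷ʳ⁺ (x ∷ xs) b F.zero    = F.zero , refl
lookup-∷ʳ⁺ (x ∷ xs) b (F.suc j) with lookup-∷ʳ⁺ xs b j
... | i , e = F.suc i , e

infix 4 _≟ⱽ_
_≟ⱽ_ : ∀ {n} → DecidableEquality (Vertex n)
_≟ⱽ_ = VP.≡-dec B._≟_

<ᴸ-irrefl : ∀ {n} (x : Vertex n) → ¬ (x <ᴸ x)
<ᴸ-irrefl []           ()
<ᴸ-irrefl (false ∷ xs) (inj₁ (_ , ()))
<ᴸ-irrefl (true ∷ xs)  (inj₁ (() , _))
<ᴸ-irrefl (x ∷ xs)     (inj₂ (_ , p)) = <ᴸ-irrefl xs p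

<ᴸ⇒≢ : ∀ {n} {x y : Vertex n} → x <ᴸ y → x ≢ y
<ᴸ⇒≢ {x = x} p refl = <ᴸ-irrefl x p

<ᴸ-trans : ∀ {n} {x y z : Vertex n} → x <ᴸ y → y <ᴸ z → x <ᴸ z
<ᴸ-trans {x = []}    {[]}    {[]}    () _
<ᴸ-trans {x = _ ∷ _} {_ ∷ _} {_ ∷ _} (inj₁ (refl , refl)) (inj₁ (() , _))
<ᴸ-trans {x = _ ∷ _} {_ ∷ _} {_ ∷ _} (inj₁ (refl , refl)) (inj₂ (refl , _)) = inj₁ (refl , refl)
<ᴸ-trans {x = _ ∷ _} {_ ∷ _} {_ ∷ _} (inj₂ (refl , _))    (inj₁ (refl , refl)) = inj₁ (refl , refl)
<ᴸ-trans {x = _ ∷ _} {_ ∷ _} {_ ∷ _} (inj₂ (refl , p))    (inj₂ (refl , q)) = inj₂ (refl , <ᴸ-trans p q)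

complement : ∀ {n} → Vertex n → Vertex n
complement = V.map not

complement-involutive : ∀ {n} (x : Vertex n) → complement (complement x) ≡ x
complement-involutive []      = refl
complement-involutive (b ∷ x) = cong₂ _∷_ (BP.not-involutive b) (complement-involutive x)

<ᴸ-complement : ∀ {n} {x y : Vertex n} → x <ᴸ y → complement y <ᴸ complement x
<ᴸ-complement {x = []}    {[]}    ()
<ᴸ-complement {x = _ ∷ _} {_ ∷ _} (inj₁ (refl , refl)) = inj₁ (refl , refl)
<ᴸ-complement {x = _ ∷ _} {_ ∷ _} (inj₂ (refl , p))    = inj₂ (refl , <ᴸ-complement p)

hamming-refl : ∀ {n} (x : Vertex n) → hamming x x ≡ 0
hamming-refl []          = refl
hamming-refl (false ∷ x) = hamming-refl x
hamming-refl (true ∷ x)  = hamming-refl x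

hamming-refl-≤ : ∀ {n} r (x : Vertex n) → hamming x x ≤ r
hamming-refl-≤ r x = subst (_≤ r) (sym (hamming-refl x)) z≤n

hamming-sym : ∀ {n} (x y : Vertex n) → hamming x y ≡ hamming y x
hamming-sym []          []          = refl
hamming-sym (false ∷ x) (false ∷ y) = hamming-sym x y
hamming-sym (false ∷ x) (true ∷ y)  = cong suc (hamming-sym x y)
hamming-sym (true ∷ x)  (false ∷ y) = cong suc (hamming-sym x y)
hamming-sym (true ∷ x)  (true ∷ y)  = hamming-sym x y

hamming-sym-≤ : ∀ {n r} (x y : Vertex n) → hamming x y ≤ r → hamming y x ≤ r
hamming-sym-≤ {r = r} x y = subst (_≤ r) (hamming-sym x y)

hamming-complement : ∀ {n} (x y : Vertex n) → hamming x (complement y) ℕ.+ hamming x y ≡ n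
hamming-complement []          []          = refl
hamming-complement (false ∷ x) (false ∷ y) = cong suc (hamming-complement x y)
hamming-complement (false ∷ x) (true ∷ y)  = trans (ℕP.+-suc _ _) (cong suc (hamming-complement x y))
hamming-complement (true ∷ x)  (false ∷ y) = trans (ℕP.+-suc _ _) (cong suc (hamming-complement x y))
hamming-complement (true ∷ x)  (true ∷ y)  = cong suc (hamming-complement x y)

hamming-complement-self : ∀ {n} (x : Vertex n) → hamming x (complement x) ≡ n
hamming-complement-self []          = refl
hamming-complement-self (false ∷ x) = cong suc (hamming-complement-self x)
hamming-complement-self (true ∷ x)  = cong suc (hamming-complement-self x)

hamming-complement-both : ∀ {n} (x y : Vertex n) → hamming (complement x) (complement y) ≡ hamming x y
hamming-complement-both []          []          = refl
hamming-complement-both (false ∷ x) (false ∷ y) = hamming-complement-both x y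
hamming-complement-both (false ∷ x) (true ∷ y)  = cong suc (hamming-complement-both x y)
hamming-complement-both (true ∷ x)  (false ∷ y) = cong suc (hamming-complement-both x y)
hamming-complement-both (true ∷ x)  (true ∷ y)  = hamming-complement-both x y

hamming-≤-dim : ∀ {n} (x y : Vertex n) → hamming x y ≤ n
hamming-≤-dim []          []          = z≤n
hamming-≤-dim (false ∷ x) (false ∷ y) = ℕP.m≤n⇒m≤1+n (hamming-≤-dim x y)
hamming-≤-dim (false ∷ x) (true ∷ y)  = s≤s (hamming-≤-dim x y)
hamming-≤-dim (true ∷ x)  (false ∷ y) = s≤s (hamming-≤-dim x y)
hamming-≤-dim (true ∷ x)  (true ∷ y)  = ℕP.m≤n⇒m≤1+n (hamming-≤-dim x y)

<ᴸ⇒hamming-pos : ∀ {n} {x y : Vertex n} → x <ᴸ y → 1 ≤ hamming x y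
<ᴸ⇒hamming-pos {x = []}        {[]}    ()
<ᴸ⇒hamming-pos {x = _ ∷ _}     {_ ∷ _} (inj₁ (refl , refl)) = s≤s z≤n
<ᴸ⇒hamming-pos {x = false ∷ _} {_ ∷ _} (inj₂ (refl , p))    = <ᴸ⇒hamming-pos p
<ᴸ⇒hamming-pos {x = true ∷ _}  {_ ∷ _} (inj₂ (refl , p))    = <ᴸ⇒hamming-pos p

-- Simplicial chains

Simplex : ℕ → ℕ → Set
Simplex n m = Vec (Vertex n) (suc m)

ite : Bool → ℤ → ℤ
ite b x = if b then x else 0ℤ

ite-zero : ∀ b → ite b 0ℤ ≡ 0ℤ
ite-zero true  = refl
ite-zero false = refl

ite-* : ∀ b s x → ite b (s * x) ≡ s * ite b x
ite-* true  s x = refl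
ite-* false s x = sym (ℤP.*-zeroʳ s)

coeff-++ : ∀ {n m} (c d : Chain n m) τ → coeff (c ++ d) τ ≡ coeff c τ + coeff d τ
coeff-++ []            d τ = sym (ℤP.+-identityˡ _)
coeff-++ ((a , σ) ∷ c) d τ =
  trans (cong (ite (does (VP.≡-dec _≟ⱽ_ σ τ)) a +_) (coeff-++ c d τ))
        (sym (ℤP.+-assoc (ite (does (VP.≡-dec _≟ⱽ_ σ τ)) a) _ _))

coeff-scale : ∀ {n m} s (c : Chain n m) τ → coeff (scale s c) τ ≡ s * coeff c τ
coeff-scale s []            τ = sym (ℤP.*-zeroʳ s)
coeff-scale s ((a , σ) ∷ c) τ =
  trans (cong₂ _+_ (ite-* (does (VP.≡-dec _≟ⱽ_ σ τ)) s a) (coeff-scale s c τ))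
        (sym (ℤP.*-distribˡ-+ s _ _))

coeff-≢ : ∀ {n m} (c : Chain n m) τ → All (λ e → proj₂ e ≢ τ) c → coeff c τ ≡ 0ℤ
coeff-≢ []            τ []          = refl
coeff-≢ ((a , σ) ∷ c) τ (σ≢τ ∷ c≢τ) with VP.≡-dec _≟ⱽ_ σ τ
... | yes σ≡τ = ⊥-elim (σ≢τ σ≡τ)
... | no _    = trans (ℤP.+-identityˡ _) (coeff-≢ c τ c≢τ)

prefix : ∀ {n m} → Vertex n → Chain n m → Chain n (suc m)
prefix a = L.map (map₂ (a ∷_))

suffix : ∀ {n m} → Vertex n → Chain n m → Chain n (suc m)
suffix b = L.map (map₂ (_∷ʳ b))

coeff-prefix : ∀ {n m} (a : Vertex n) (c : Chain n m) y ρ →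
  coeff (prefix a c) (y ∷ ρ) ≡ ite (does (a ≟ⱽ y)) (coeff c ρ)
coeff-prefix a [] y ρ with does (a ≟ⱽ y)
... | true  = refl
... | false = refl
coeff-prefix a ((x , σ) ∷ c) y ρ with does (a ≟ⱽ y) | coeff-prefix a c y ρ
... | true  | ih = cong (ite (does (VP.≡-dec _≟ⱽ_ σ ρ)) x +_) ih
... | false | ih = trans (ℤP.+-identityˡ _) ih

does-≡-dec-∷ʳ : ∀ {A : Set} (_≟_ : DecidableEquality A) {k} (σ ρ : Vec A k) b y →
  does (VP.≡-dec _≟_ (σ ∷ʳ b) (ρ ∷ʳ y)) ≡ does (b ≟ y) ∧ does (VP.≡-dec _≟_ σ ρ)
does-≡-dec-∷ʳ _≟_ []      []      b y = refl
does-≡-dec-∷ʳ _≟_ (s ∷ σ) (t ∷ ρ) b y =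
  trans (cong (does (s ≟ t) ∧_) (does-≡-dec-∷ʳ _≟_ σ ρ b y))
        (∧-swap (does (s ≟ t)) (does (b ≟ y)) (does (VP.≡-dec _≟_ σ ρ)))
  where
  ∧-swap : ∀ p q r → p ∧ (q ∧ r) ≡ q ∧ (p ∧ r)
  ∧-swap p q r = trans (sym (BP.∧-assoc p q r))
                       (trans (cong (_∧ r) (BP.∧-comm p q)) (BP.∧-assoc q p r))

coeff-suffix : ∀ {n m} (b : Vertex n) (c : Chain n m) ρ y →
  coeff (suffix b c) (ρ ∷ʳ y) ≡ ite (does (b ≟ⱽ y)) (coeff c ρ)
coeff-suffix b [] ρ y with does (b ≟ⱽ y)
... | true  = refl
... | false = refl
coeff-suffix b ((x , σ) ∷ c) ρ y
  rewrite does-≡-dec-∷ʳ _≟ⱽ_ σ ρ b y with does (b ≟ⱽ y) | coeff-suffix b c ρ y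
... | true  | ih = cong (ite (does (VP.≡-dec _≟ⱽ_ σ ρ)) x +_) ih
... | false | ih = trans (ℤP.+-identityˡ _) ih

coeff-suffix-last′ : ∀ {n m} (b : Vertex n) (c : Chain n m) τ →
  coeff (suffix b c) τ ≡ ite (does (b ≟ⱽ last′ τ)) (coeff c (init′ τ))
coeff-suffix-last′ b c τ =
  trans (cong (coeff (suffix b c)) (init′-∷ʳ-last′ τ)) (coeff-suffix b c (init′ τ) (last′ τ))

prefix-null : ∀ {n m} (a : Vertex n) (c : Chain n m) → (∀ ρ → coeff c ρ ≡ 0ℤ) →
  ∀ ρ → coeff (prefix a c) ρ ≡ 0ℤ
prefix-null a c c≡0 (y ∷ ρ) = trans (coeff-prefix a c y ρ) (trans (cong (ite _) (c≡0 ρ)) (ite-zero _))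

suffix-null : ∀ {n m} (b : Vertex n) (c : Chain n m) → (∀ ρ → coeff c ρ ≡ 0ℤ) →
  ∀ ρ → coeff (suffix b c) ρ ≡ 0ℤ
suffix-null b c c≡0 ρ = trans (coeff-suffix-last′ b c ρ) (trans (cong (ite _) (c≡0 _)) (ite-zero _))

prefix-scale : ∀ {n m} (a : Vertex n) s (c : Chain n m) → prefix a (scale s c) ≡ scale s (prefix a c)
prefix-scale a s []      = refl
prefix-scale a s (_ ∷ c) = cong (_ ∷_) (prefix-scale a s c)

suffix-scale : ∀ {n m} (b : Vertex n) s (c : Chain n m) → suffix b (scale s c) ≡ scale s (suffix b c)
suffix-scale b s []      = refl
suffix-scale b s (_ ∷ c) = cong (_ ∷_) (suffix-scale b s c)

suffix-prefix : ∀ {n m} (a b : Vertex n) (c : Chain n m) → suffix b (prefix a c) ≡ prefix a (suffix b c)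
suffix-prefix a b []      = refl
suffix-prefix a b (_ ∷ c) = cong (_ ∷_) (suffix-prefix a b c)

sign-suc : ∀ k → sign (suc k) ≡ - sign k
sign-suc zero          = refl
sign-suc (suc zero)    = refl
sign-suc (suc (suc k)) = sign-suc k

sign-*-sign : ∀ k → sign k * sign k ≡ 1ℤ
sign-*-sign zero          = refl
sign-*-sign (suc zero)    = refl
sign-*-sign (suc (suc k)) = sign-*-sign k

faces : ∀ {n m} → ℤ → Simplex n (suc m) → Chain n m
faces x σ = V.toList (tabulate (λ i → (sign (toℕ i) * x , removeAt σ i)))

∂-∷ : ∀ {n m} x (σ : Simplex n (suc m)) (c : Chain n (suc m)) → ∂ ((x , σ) ∷ c) ≡ faces x σ ++ ∂ c
∂-∷ x σ c = cong (λ l → V.toList l ++ ∂ c) (sym (VP.tabulate-allFin _))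

∂-++ : ∀ {n m} (c d : Chain n (suc m)) → ∂ (c ++ d) ≡ ∂ c ++ ∂ d
∂-++ c d = LP.concatMap-++ _ c d

scale-tabulate : ∀ {n m k} s (g : Fin k → ℤ × Simplex n m) →
  scale s (V.toList (tabulate g)) ≡ V.toList (tabulate (λ i → (s * proj₁ (g i) , proj₂ (g i))))
scale-tabulate {k = zero}  s g = refl
scale-tabulate {k = suc k} s g = cong (_ ∷_) (scale-tabulate s (g ∘ F.suc))

prefix-tabulate : ∀ {n m k} a (g : Fin k → ℤ × Simplex n m) →
  prefix a (V.toList (tabulate g)) ≡ V.toList (tabulate (λ i → (proj₁ (g i) , a ∷ proj₂ (g i))))
prefix-tabulate {k = zero}  a g = refl
prefix-tabulate {k = suc k} a g = cong (_ ∷_) (prefix-tabulate a (g ∘ F.suc))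

faces-scale : ∀ {n m} s x (σ : Simplex n (suc m)) → faces (s * x) σ ≡ scale s (faces x σ)
faces-scale s x σ = sym (trans (scale-tabulate s (λ i → (sign (toℕ i) * x , removeAt σ i)))
  (cong V.toList (VP.tabulate-cong (λ i → cong (_, removeAt σ i) (swap s (sign (toℕ i)) x)))))
  where
  swap : ∀ s t x → s * (t * x) ≡ t * (s * x)
  swap = solve-∀

faces-prefix : ∀ {n m} x (a : Vertex n) (σ : Simplex n (suc m)) →
  faces x (a ∷ σ) ≡ (sign 0 * x , σ) ∷ prefix a (scale -1ℤ (faces x σ))
faces-prefix {n} {m} x a σ@(_ ∷ _) = cong ((sign 0 * x , σ) ∷_) (sym (begin
    prefix a (scale -1ℤ (faces x σ))
  ≡⟨ cong (prefix a) (scale-tabulate -1ℤ face) ⟩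
    prefix a (V.toList (tabulate (λ i → (-1ℤ * proj₁ (face i) , proj₂ (face i)))))
  ≡⟨ prefix-tabulate a (λ i → (-1ℤ * proj₁ (face i) , proj₂ (face i))) ⟩
    V.toList (tabulate (λ i → (-1ℤ * (sign (toℕ i) * x) , a ∷ removeAt σ i)))
  ≡⟨ cong V.toList (VP.tabulate-cong (λ i → cong (_, a ∷ removeAt σ i) (shifted-sign (toℕ i)))) ⟩
    V.toList (tabulate (λ i → (sign (suc (toℕ i)) * x , a ∷ removeAt σ i)))
  ∎))
  where
  open ≡-Reasoning
  face : Fin (suc (suc m)) → ℤ × Simplex n m
  face i = (sign (toℕ i) * x , removeAt σ i)
  neg-* : ∀ s x → -1ℤ * (s * x) ≡ (- s) * x
  neg-* = solve-∀
  shifted-sign : ∀ k → -1ℤ * (sign k * x) ≡ sign (suc k) * x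
  shifted-sign k = trans (neg-* (sign k) x) (cong (_* x) (sym (sign-suc k)))

coeff-∂-scale : ∀ {n m} s (c : Chain n (suc m)) ρ → coeff (∂ (scale s c)) ρ ≡ s * coeff (∂ c) ρ
coeff-∂-scale s []            ρ = sym (ℤP.*-zeroʳ s)
coeff-∂-scale s ((x , σ) ∷ c) ρ = begin
    coeff (∂ ((s * x , σ) ∷ scale s c)) ρ
  ≡⟨ cong (λ l → coeff l ρ) (∂-∷ (s * x) σ (scale s c)) ⟩
    coeff (faces (s * x) σ ++ ∂ (scale s c)) ρ
  ≡⟨ coeff-++ (faces (s * x) σ) _ ρ ⟩
    coeff (faces (s * x) σ) ρ + coeff (∂ (scale s c)) ρ
  ≡⟨ cong₂ _+_ (trans (cong (λ l → coeff l ρ) (faces-scale s x σ)) (coeff-scale s (faces x σ) ρ))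
               (coeff-∂-scale s c ρ) ⟩
    s * coeff (faces x σ) ρ + s * coeff (∂ c) ρ
  ≡⟨ sym (ℤP.*-distribˡ-+ s _ _) ⟩
    s * (coeff (faces x σ) ρ + coeff (∂ c) ρ)
  ≡⟨ cong (s *_) (sym (trans (cong (λ l → coeff l ρ) (∂-∷ x σ c)) (coeff-++ (faces x σ) _ ρ))) ⟩
    s * coeff (∂ ((x , σ) ∷ c)) ρ
  ∎
  where open ≡-Reasoning

coeff-∂-prefix : ∀ {n m} (a : Vertex n) (c : Chain n (suc m)) ρ →
  coeff (∂ (prefix a c)) ρ ≡ coeff c ρ - coeff (prefix a (∂ c)) ρ
coeff-∂-prefix a []            ρ = refl
coeff-∂-prefix a ((x , σ) ∷ c) ρ = begin
    coeff (∂ ((x , a ∷ σ) ∷ prefix a c)) ρ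
  ≡⟨ cong (λ l → coeff l ρ) (∂-∷ x (a ∷ σ) (prefix a c)) ⟩
    coeff (faces x (a ∷ σ) ++ ∂ (prefix a c)) ρ
  ≡⟨ coeff-++ (faces x (a ∷ σ)) _ ρ ⟩
    coeff (faces x (a ∷ σ)) ρ + coeff (∂ (prefix a c)) ρ
  ≡⟨ cong₂ _+_ (cong (λ l → coeff l ρ) (faces-prefix x a σ)) (coeff-∂-prefix a c ρ) ⟩
    (ite σ≟ρ (1ℤ * x) + coeff (prefix a (scale -1ℤ (faces x σ))) ρ) + (coeff c ρ - coeff (prefix a (∂ c)) ρ)
  ≡⟨ cong₂ (λ u v → (ite σ≟ρ u + v) + (coeff c ρ - coeff (prefix a (∂ c)) ρ))
       (ℤP.*-identityˡ x)
       (trans (cong (λ l → coeff l ρ) (prefix-scale a -1ℤ (faces x σ))) (coeff-scale -1ℤ (prefix a (faces x σ)) ρ)) ⟩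
    (ite σ≟ρ x + -1ℤ * coeff (prefix a (faces x σ)) ρ) + (coeff c ρ - coeff (prefix a (∂ c)) ρ)
  ≡⟨ regroup (ite σ≟ρ x) _ _ _ ⟩
    (ite σ≟ρ x + coeff c ρ) - (coeff (prefix a (faces x σ)) ρ + coeff (prefix a (∂ c)) ρ)
  ≡⟨ cong (λ t → (ite σ≟ρ x + coeff c ρ) - t) (sym (coeff-++ (prefix a (faces x σ)) _ ρ)) ⟩
    (ite σ≟ρ x + coeff c ρ) - coeff (prefix a (faces x σ) ++ prefix a (∂ c)) ρ
  ≡⟨ cong (λ l → (ite σ≟ρ x + coeff c ρ) - coeff l ρ)
       (trans (sym (LP.map-++ _ (faces x σ) (∂ c))) (cong (prefix a) (sym (∂-∷ x σ c)))) ⟩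
    coeff ((x , σ) ∷ c) ρ - coeff (prefix a (∂ ((x , σ) ∷ c))) ρ
  ∎
  where
  open ≡-Reasoning
  σ≟ρ = does (VP.≡-dec _≟ⱽ_ σ ρ)
  regroup : ∀ p q r s → (p + -1ℤ * q) + (r - s) ≡ (p + r) - (q + s)
  regroup = solve-∀

coeff-faces-suffix : ∀ {n m} x (b : Vertex n) (σ : Simplex n (suc m)) ρ →
  coeff (faces x (σ ∷ʳ b)) ρ ≡ coeff (suffix b (faces x σ)) ρ + ite (does (VP.≡-dec _≟ⱽ_ σ ρ)) (sign m * x)
coeff-faces-suffix {m = zero} x b (y ∷ z ∷ []) ρ =
  rotate (ite (does (VP.≡-dec _≟ⱽ_ (z ∷ b ∷ []) ρ)) (sign 0 * x))
         (ite (does (VP.≡-dec _≟ⱽ_ (y ∷ b ∷ []) ρ)) (sign 1 * x))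
         (ite (does (VP.≡-dec _≟ⱽ_ (y ∷ z ∷ []) ρ)) (sign 0 * x))
  where
  rotate : ∀ p q r → p + (q + (r + 0ℤ)) ≡ (p + (q + 0ℤ)) + r
  rotate = solve-∀
coeff-faces-suffix {m = suc m} x b (y ∷ σ) (z ∷ ρ) = begin
    coeff (faces x (y ∷ (σ ∷ʳ b))) (z ∷ ρ)
  ≡⟨ cong (λ l → coeff l (z ∷ ρ)) (faces-prefix x y (σ ∷ʳ b)) ⟩
    first + coeff (prefix y (scale -1ℤ (faces x (σ ∷ʳ b)))) (z ∷ ρ)
  ≡⟨ cong (first +_) tail-faces ⟩
    first + (coeff (suffix b (prefix y (scale -1ℤ (faces x σ)))) (z ∷ ρ) + ite (y≟z ∧ σ≟ρ) (sign (suc m) * x))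
  ≡⟨ sym (ℤP.+-assoc first _ _) ⟩
    (first + coeff (suffix b (prefix y (scale -1ℤ (faces x σ)))) (z ∷ ρ)) + ite (y≟z ∧ σ≟ρ) (sign (suc m) * x)
  ≡⟨ cong (λ l → coeff (suffix b l) (z ∷ ρ) + ite (y≟z ∧ σ≟ρ) (sign (suc m) * x)) (sym (faces-prefix x y σ)) ⟩
    coeff (suffix b (faces x (y ∷ σ))) (z ∷ ρ) + ite (y≟z ∧ σ≟ρ) (sign (suc m) * x)
  ∎
  where
  open ≡-Reasoning
  first = ite (does (VP.≡-dec _≟ⱽ_ (σ ∷ʳ b) (z ∷ ρ))) (sign 0 * x)
  y≟z = does (y ≟ⱽ z)
  σ≟ρ = does (VP.≡-dec _≟ⱽ_ σ ρ)
  neg-* : ∀ s x → -1ℤ * (s * x) ≡ (- s) * x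
  neg-* = solve-∀
  distrib-ite : ∀ p q s x → ite p (-1ℤ * (s + ite q x)) ≡ ite p (-1ℤ * s) + ite (p ∧ q) (-1ℤ * x)
  distrib-ite false q s x = refl
  distrib-ite true  true  s x = ℤP.*-distribˡ-+ -1ℤ s x
  distrib-ite true  false s x = trans (cong (-1ℤ *_) (ℤP.+-identityʳ s)) (sym (ℤP.+-identityʳ _))
  tail-faces : coeff (prefix y (scale -1ℤ (faces x (σ ∷ʳ b)))) (z ∷ ρ)
             ≡ coeff (suffix b (prefix y (scale -1ℤ (faces x σ)))) (z ∷ ρ) + ite (y≟z ∧ σ≟ρ) (sign (suc m) * x)
  tail-faces = begin
      coeff (prefix y (scale -1ℤ (faces x (σ ∷ʳ b)))) (z ∷ ρ)
    ≡⟨ coeff-prefix y (scale -1ℤ (faces x (σ ∷ʳ b))) z ρ ⟩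
      ite y≟z (coeff (scale -1ℤ (faces x (σ ∷ʳ b))) ρ)
    ≡⟨ cong (ite y≟z) (trans (coeff-scale -1ℤ (faces x (σ ∷ʳ b)) ρ) (cong (-1ℤ *_) (coeff-faces-suffix x b σ ρ))) ⟩
      ite y≟z (-1ℤ * (coeff (suffix b (faces x σ)) ρ + ite σ≟ρ (sign m * x)))
    ≡⟨ distrib-ite y≟z σ≟ρ _ (sign m * x) ⟩
      ite y≟z (-1ℤ * coeff (suffix b (faces x σ)) ρ) + ite (y≟z ∧ σ≟ρ) (-1ℤ * (sign m * x))
    ≡⟨ cong₂ _+_ (cong (ite y≟z) (sym (coeff-scale -1ℤ (suffix b (faces x σ)) ρ)))
                 (cong (ite (y≟z ∧ σ≟ρ)) (trans (neg-* (sign m) x) (cong (_* x) (sym (sign-suc m))))) ⟩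
      ite y≟z (coeff (scale -1ℤ (suffix b (faces x σ))) ρ) + ite (y≟z ∧ σ≟ρ) (sign (suc m) * x)
    ≡⟨ cong (_+ ite (y≟z ∧ σ≟ρ) (sign (suc m) * x))
         (sym (trans (coeff-prefix y (suffix b (scale -1ℤ (faces x σ))) z ρ)
                    (cong (λ l → ite y≟z (coeff l ρ)) (suffix-scale b -1ℤ (faces x σ))))) ⟩
      coeff (prefix y (suffix b (scale -1ℤ (faces x σ)))) (z ∷ ρ) + ite (y≟z ∧ σ≟ρ) (sign (suc m) * x)
    ≡⟨ cong (λ l → coeff l (z ∷ ρ) + ite (y≟z ∧ σ≟ρ) (sign (suc m) * x))
         (sym (suffix-prefix y b (scale -1ℤ (faces x σ)))) ⟩
      coeff (suffix b (prefix y (scale -1ℤ (faces x σ)))) (z ∷ ρ) + ite (y≟z ∧ σ≟ρ) (sign (suc m) * x)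
    ∎

coeff-∂-suffix : ∀ {n m} (b : Vertex n) (c : Chain n (suc m)) ρ →
  coeff (∂ (suffix b c)) ρ ≡ coeff (suffix b (∂ c)) ρ + sign m * coeff c ρ
coeff-∂-suffix {m = m} b []            ρ = sym (cong (0ℤ +_) (ℤP.*-zeroʳ (sign m)))
coeff-∂-suffix {m = m} b ((x , σ) ∷ c) ρ = begin
    coeff (∂ ((x , σ ∷ʳ b) ∷ suffix b c)) ρ
  ≡⟨ cong (λ l → coeff l ρ) (∂-∷ x (σ ∷ʳ b) (suffix b c)) ⟩
    coeff (faces x (σ ∷ʳ b) ++ ∂ (suffix b c)) ρ
  ≡⟨ coeff-++ (faces x (σ ∷ʳ b)) _ ρ ⟩
    coeff (faces x (σ ∷ʳ b)) ρ + coeff (∂ (suffix b c)) ρ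
  ≡⟨ cong₂ _+_ (coeff-faces-suffix x b σ ρ) (coeff-∂-suffix b c ρ) ⟩
    (coeff (suffix b (faces x σ)) ρ + ite σ≟ρ (sign m * x)) + (coeff (suffix b (∂ c)) ρ + sign m * coeff c ρ)
  ≡⟨ interchange (coeff (suffix b (faces x σ)) ρ) _ _ _ ⟩
    (coeff (suffix b (faces x σ)) ρ + coeff (suffix b (∂ c)) ρ) + (ite σ≟ρ (sign m * x) + sign m * coeff c ρ)
  ≡⟨ cong₂ _+_ (sym (coeff-++ (suffix b (faces x σ)) _ ρ))
       (trans (cong (_+ sign m * coeff c ρ) (ite-* σ≟ρ (sign m) x)) (sym (ℤP.*-distribˡ-+ (sign m) _ _))) ⟩
    coeff (suffix b (faces x σ) ++ suffix b (∂ c)) ρ + sign m * (ite σ≟ρ x + coeff c ρ)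
  ≡⟨ cong (λ l → coeff l ρ + sign m * (ite σ≟ρ x + coeff c ρ))
       (trans (sym (LP.map-++ _ (faces x σ) (∂ c))) (cong (suffix b) (sym (∂-∷ x σ c)))) ⟩
    coeff (suffix b (∂ ((x , σ) ∷ c))) ρ + sign m * coeff ((x , σ) ∷ c) ρ
  ∎
  where
  open ≡-Reasoning
  σ≟ρ = does (VP.≡-dec _≟ⱽ_ σ ρ)
  interchange : ∀ p q r s → (p + q) + (r + s) ≡ (p + r) + (q + s)
  interchange = solve-∀

-- Cross-polytopes

Pair : ℕ → Set
Pair n = Vertex n × Vertex n

-- b is appended so that simplices stay increasing; the sign makes the boundaries of the two cones cancel.
suspension : ∀ {n m} → Pair n → Chain n m → Chain n (suc m)
suspension {m = m} (a , b) c = prefix a c ++ scale (sign m) (suffix b c)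

crossPolytope : ∀ {n} (m : ℕ) → List (Pair n) → Chain n m
crossPolytope zero    []            = []
crossPolytope zero    ((a , b) ∷ _) = (1ℤ , a ∷ []) ∷ (-1ℤ , b ∷ []) ∷ []
crossPolytope (suc m) []            = []
crossPolytope (suc m) (p ∷ ps)      = suspension p (crossPolytope m ps)

suspension-cycle : ∀ {n m} (p : Pair n) (c : Chain n (suc m)) → (∀ ρ → coeff (∂ c) ρ ≡ 0ℤ) →
  ∀ ρ → coeff (∂ (suspension p c)) ρ ≡ 0ℤ
suspension-cycle {m = m} (a , b) c ∂c≡0 ρ = begin
    coeff (∂ (prefix a c ++ scale s (suffix b c))) ρ
  ≡⟨ cong (λ l → coeff l ρ) (∂-++ (prefix a c) _) ⟩
    coeff (∂ (prefix a c) ++ ∂ (scale s (suffix b c))) ρ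
  ≡⟨ coeff-++ (∂ (prefix a c)) _ ρ ⟩
    coeff (∂ (prefix a c)) ρ + coeff (∂ (scale s (suffix b c))) ρ
  ≡⟨ cong₂ _+_ (coeff-∂-prefix a c ρ) (trans (coeff-∂-scale s (suffix b c) ρ) (cong (s *_) (coeff-∂-suffix b c ρ))) ⟩
    (coeff c ρ - coeff (prefix a (∂ c)) ρ) + s * (coeff (suffix b (∂ c)) ρ + sign m * coeff c ρ)
  ≡⟨ cong₂ (λ u v → (coeff c ρ - u) + s * (v + sign m * coeff c ρ))
       (prefix-null a (∂ c) ∂c≡0 ρ) (suffix-null b (∂ c) ∂c≡0 ρ) ⟩
    (coeff c ρ - 0ℤ) + s * (0ℤ + sign m * coeff c ρ)
  ≡⟨ cong (λ t → (coeff c ρ - 0ℤ) + t * (0ℤ + sign m * coeff c ρ)) (sign-suc m) ⟩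
    (coeff c ρ - 0ℤ) + (- sign m) * (0ℤ + sign m * coeff c ρ)
  ≡⟨ expand (coeff c ρ) (sign m) ⟩
    coeff c ρ - (sign m * sign m) * coeff c ρ
  ≡⟨ cong (λ t → coeff c ρ - t * coeff c ρ) (sign-*-sign m) ⟩
    coeff c ρ - 1ℤ * coeff c ρ
  ≡⟨ cancel (coeff c ρ) ⟩
    0ℤ
  ∎
  where
  open ≡-Reasoning
  s = sign (suc m)
  expand : ∀ w t → (w - 0ℤ) + (- t) * (0ℤ + t * w) ≡ w - (t * t) * w
  expand = solve-∀
  cancel : ∀ w → w - 1ℤ * w ≡ 0ℤ
  cancel = solve-∀

crossPolytope-cycle : ∀ {n} m (ps : List (Pair n)) ρ → coeff (∂ (crossPolytope (suc m) ps)) ρ ≡ 0ℤ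
crossPolytope-cycle zero [] ρ = refl
crossPolytope-cycle zero (_ ∷ []) ρ = refl
crossPolytope-cycle zero ((a , b) ∷ (c , d) ∷ _) ρ
  with does (VP.≡-dec _≟ⱽ_ (a ∷ []) ρ) | does (VP.≡-dec _≟ⱽ_ (b ∷ []) ρ)
     | does (VP.≡-dec _≟ⱽ_ (c ∷ []) ρ) | does (VP.≡-dec _≟ⱽ_ (d ∷ []) ρ)
... | true  | true  | true  | true  = refl
... | true  | true  | true  | false = refl
... | true  | true  | false | true  = refl
... | true  | true  | false | false = refl
... | true  | false | true  | true  = refl
... | true  | false | true  | false = refl
... | true  | false | false | true  = refl
... | true  | false | false | false = refl
... | false | true  | true  | true  = refl
... | false | true  | true  | false = refl
... | false | true  | false | true  = refl
... | false | true  | false | false = refl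
... | false | false | true  | true  = refl
... | false | false | true  | false = refl
... | false | false | false | true  = refl
... | false | false | false | false = refl
crossPolytope-cycle (suc m) [] ρ = refl
crossPolytope-cycle (suc m) (p ∷ ps) ρ =
  suspension-cycle p (crossPolytope (suc m) ps) (crossPolytope-cycle m ps) ρ

vertices : ∀ {n} → List (Pair n) → List (Vertex n)
vertices = L.concatMap (λ p → proj₁ p ∷ proj₂ p ∷ [])

record Between {n} (r : ℕ) (ab : Pair n) (v : Vertex n) : Set where
  constructor between
  field
    after-a  : proj₁ ab <ᴸ v
    before-b : v <ᴸ proj₂ ab
    near-a   : hamming (proj₁ ab) v ≤ r
    near-b   : hamming (proj₂ ab) v ≤ r

open Between

Nested : ∀ {n} (r : ℕ) → List (Pair n) → Set
Nested r []             = ⊤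
Nested r ((a , b) ∷ ps) = a <ᴸ b × All (Between r (a , b)) (vertices ps) × Nested r ps

SimplexOn : ∀ {n} (r : ℕ) → List (Pair n) → ∀ {m} → Simplex n m → Set
SimplexOn {n} r ps σ = IsVRSimplex n r σ × (∀ i → lookup σ i ∈ vertices ps)

Increasing-∷ : ∀ {n k} a (σ : Vec (Vertex n) (suc k)) → a <ᴸ lookup σ F.zero → Increasing σ → Increasing (a ∷ σ)
Increasing-∷ a (_ ∷ _) a<σ₀ σ↑ = a<σ₀ , σ↑

Increasing-∷ʳ : ∀ {n k} (σ : Vec (Vertex n) (suc k)) b → last′ σ <ᴸ b → Increasing σ → Increasing (σ ∷ʳ b)
Increasing-∷ʳ (x ∷ [])     b x<b _         = x<b , tt
Increasing-∷ʳ (x ∷ y ∷ σ) b σ<b (x<y , σ↑) = x<y , Increasing-∷ʳ (y ∷ σ) b σ<b σ↑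

SimplexOn-prefix : ∀ {n r m} a b (ps : List (Pair n)) (σ : Simplex n m) →
  All (Between r (a , b)) (vertices ps) → SimplexOn r ps σ → SimplexOn r ((a , b) ∷ ps) (a ∷ σ)
SimplexOn-prefix {r = r} a b ps σ inside ((σ↑ , dist) , mem) =
  (Increasing-∷ a σ (after-a (near F.zero)) σ↑ , dist′) , mem′
  where
  near : ∀ j → Between r (a , b) (lookup σ j)
  near j = All.lookup inside (mem j)
  dist′ : ∀ i j → hamming (lookup (a ∷ σ) i) (lookup (a ∷ σ) j) ≤ r
  dist′ F.zero    F.zero    = hamming-refl-≤ r a
  dist′ F.zero    (F.suc j) = near-a (near j)
  dist′ (F.suc i) F.zero    = hamming-sym-≤ a _ (near-a (near i))
  dist′ (F.suc i) (F.suc j) = dist i j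
  mem′ : ∀ i → lookup (a ∷ σ) i ∈ vertices ((a , b) ∷ ps)
  mem′ F.zero    = here refl
  mem′ (F.suc i) = there (there (mem i))

SimplexOn-suffix : ∀ {n r m} a b (ps : List (Pair n)) (σ : Simplex n m) →
  All (Between r (a , b)) (vertices ps) → SimplexOn r ps σ → SimplexOn r ((a , b) ∷ ps) (σ ∷ʳ b)
SimplexOn-suffix {r = r} a b ps σ inside ((σ↑ , dist) , mem) =
  (Increasing-∷ʳ σ b last<b σ↑ , dist′) , mem′
  where
  near : ∀ j → Between r (a , b) (lookup σ j)
  near j = All.lookup inside (mem j)
  last<b : last′ σ <ᴸ b
  last<b with last′-lookup σ
  ... | i , e = subst (_<ᴸ b) (sym e) (before-b (near i))
  dist′ : ∀ i j → hamming (lookup (σ ∷ʳ b) i) (lookup (σ ∷ʳ b) j) ≤ r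
  dist′ i j with lookup-∷ʳ⁻ σ b i | lookup-∷ʳ⁻ σ b j
  ... | inj₁ e₁        | inj₁ e₂        rewrite e₁ | e₂ = hamming-refl-≤ r b
  ... | inj₁ e₁        | inj₂ (j′ , e₂) rewrite e₁ | e₂ = near-b (near j′)
  ... | inj₂ (i′ , e₁) | inj₁ e₂        rewrite e₁ | e₂ = hamming-sym-≤ b _ (near-b (near i′))
  ... | inj₂ (i′ , e₁) | inj₂ (j′ , e₂) rewrite e₁ | e₂ = dist i′ j′
  mem′ : ∀ i → lookup (σ ∷ʳ b) i ∈ vertices ((a , b) ∷ ps)
  mem′ i with lookup-∷ʳ⁻ σ b i
  ... | inj₁ e       = there (here e)
  ... | inj₂ (j , e) = there (there (subst (_∈ vertices ps) (sym e) (mem j)))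

crossPolytope-SimplexOn : ∀ {n r} m (ps : List (Pair n)) → Nested r ps →
  All (λ e → SimplexOn r ps (proj₂ e)) (crossPolytope m ps)
crossPolytope-SimplexOn zero [] _ = []
crossPolytope-SimplexOn {r = r} zero ((a , b) ∷ ps) _ = vertex (here refl) ∷ vertex (there (here refl)) ∷ []
  where
  vertex : ∀ {v} → v ∈ vertices ((a , b) ∷ ps) → SimplexOn r ((a , b) ∷ ps) (v ∷ [])
  vertex {v} v∈ = (tt , λ { F.zero F.zero → hamming-refl-≤ r v }) , λ { F.zero → v∈ }
crossPolytope-SimplexOn (suc m) [] _ = []
crossPolytope-SimplexOn (suc m) ((a , b) ∷ ps) (_ , inside , nested) =
  AllP.++⁺ (AllP.map⁺ (All.map (SimplexOn-prefix a b ps _ inside) on))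
           (AllP.map⁺ (AllP.map⁺ (All.map (SimplexOn-suffix a b ps _ inside) on)))
  where
  on = crossPolytope-SimplexOn m ps nested

pick : ∀ {n} → (Vertex n → Bool) → Pair n → Vertex n
pick choose (a , b) = if choose a then a else b

selectFacet : ∀ {n} → (Vertex n → Bool) → (m : ℕ) → List (Pair n) → Simplex n m
selectFacet choose zero    []             = V.replicate _ (V.replicate _ false)
selectFacet choose zero    (p ∷ _)        = pick choose p ∷ []
selectFacet choose (suc m) []             = V.replicate _ (V.replicate _ false)
selectFacet choose (suc m) ((a , b) ∷ ps) =
  if choose a then a ∷ selectFacet choose m ps else selectFacet choose m ps ∷ʳ b

selectFacet-⊆ : ∀ {n} choose m (ps : List (Pair n)) → L.length ps ≡ suc m →
  ∀ i → lookup (selectFacet choose m ps) i ∈ vertices ps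
selectFacet-⊆ choose zero ((a , b) ∷ []) _ F.zero with choose a
... | true  = here refl
... | false = there (here refl)
selectFacet-⊆ choose (suc m) ((a , b) ∷ ps) len i with choose a
selectFacet-⊆ choose (suc m) ((a , b) ∷ ps) len F.zero    | true = here refl
selectFacet-⊆ choose (suc m) ((a , b) ∷ ps) len (F.suc i) | true =
  there (there (selectFacet-⊆ choose m ps (ℕP.suc-injective len) i))
selectFacet-⊆ choose (suc m) ((a , b) ∷ ps) len i | false with lookup-∷ʳ⁻ (selectFacet choose m ps) b i
... | inj₁ e       = there (here e)
... | inj₂ (j , e) = there (there (subst (_∈ vertices ps) (sym e) (selectFacet-⊆ choose m ps (ℕP.suc-injective len) j)))

selectFacet-pick : ∀ {n} choose m (ps : List (Pair n)) → L.length ps ≡ suc m →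
  ∀ {p} → p ∈ ps → ∃ λ i → lookup (selectFacet choose m ps) i ≡ pick choose p
selectFacet-pick choose zero    (q ∷ [])       _   (here refl) = F.zero , refl
selectFacet-pick choose (suc m) ((a , b) ∷ ps) len (here refl) with choose a
... | true  = F.zero , refl
... | false = lookup-∷ʳ-last (selectFacet choose m ps) b
selectFacet-pick choose (suc m) ((a , b) ∷ ps) len (there p∈)
  with selectFacet-pick choose m ps (ℕP.suc-injective len) p∈ | choose a
... | i , e | true  = F.suc i , e
... | i , e | false with lookup-∷ʳ⁺ (selectFacet choose m ps) b i
... | j , e′ = j , trans e′ e

coeff-suspension-∷ : ∀ {n m} (a b : Vertex n) (c : Chain n m) (τ : Simplex n m) →
  b ≢ last′ τ → coeff (suspension (a , b) c) (a ∷ τ) ≡ coeff c τ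
coeff-suspension-∷ {m = m} a b c τ@(_ ∷ _) b≢last = begin
    coeff (prefix a c ++ scale (sign m) (suffix b c)) (a ∷ τ)
  ≡⟨ coeff-++ (prefix a c) _ (a ∷ τ) ⟩
    coeff (prefix a c) (a ∷ τ) + coeff (scale (sign m) (suffix b c)) (a ∷ τ)
  ≡⟨ cong₂ _+_ (trans (coeff-prefix a c a τ) (cong (λ t → ite t (coeff c τ)) (dec-true (a ≟ⱽ a) refl)))
               (coeff-scale (sign m) (suffix b c) (a ∷ τ)) ⟩
    coeff c τ + sign m * coeff (suffix b c) (a ∷ τ)
  ≡⟨ cong (λ t → coeff c τ + sign m * t)
       (trans (coeff-suffix-last′ b c (a ∷ τ))
              (cong (λ t → ite t (coeff c (init′ (a ∷ τ)))) (dec-false (b ≟ⱽ _) b≢last))) ⟩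
    coeff c τ + sign m * 0ℤ
  ≡⟨ trans (cong (coeff c τ +_) (ℤP.*-zeroʳ (sign m))) (ℤP.+-identityʳ _) ⟩
    coeff c τ
  ∎
  where open ≡-Reasoning

coeff-suspension-∷ʳ : ∀ {n m} (a b : Vertex n) (c : Chain n m) (τ : Simplex n m) →
  a ≢ lookup τ F.zero → coeff (suspension (a , b) c) (τ ∷ʳ b) ≡ sign m * coeff c τ
coeff-suspension-∷ʳ {m = m} a b c τ@(x ∷ τ′) a≢head = begin
    coeff (prefix a c ++ scale (sign m) (suffix b c)) (τ ∷ʳ b)
  ≡⟨ coeff-++ (prefix a c) _ (τ ∷ʳ b) ⟩
    coeff (prefix a c) (x ∷ (τ′ ∷ʳ b)) + coeff (scale (sign m) (suffix b c)) (τ ∷ʳ b)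
  ≡⟨ cong₂ _+_ (trans (coeff-prefix a c x (τ′ ∷ʳ b))
                      (cong (λ t → ite t (coeff c (τ′ ∷ʳ b))) (dec-false (a ≟ⱽ _) a≢head)))
               (coeff-scale (sign m) (suffix b c) (τ ∷ʳ b)) ⟩
    0ℤ + sign m * coeff (suffix b c) (τ ∷ʳ b)
  ≡⟨ ℤP.+-identityˡ _ ⟩
    sign m * coeff (suffix b c) (τ ∷ʳ b)
  ≡⟨ cong (sign m *_) (trans (coeff-suffix b c τ b) (cong (λ t → ite t (coeff c τ)) (dec-true (b ≟ⱽ b) refl))) ⟩
    sign m * coeff c τ
  ∎
  where open ≡-Reasoning

∣sign∣≡1 : ∀ k → ℤ.∣ sign k ∣ ≡ 1
∣sign∣≡1 zero          = refl
∣sign∣≡1 (suc zero)    = refl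
∣sign∣≡1 (suc (suc k)) = ∣sign∣≡1 k

crossPolytope-facet : ∀ {n r} choose m (ps : List (Pair n)) → Nested r ps → L.length ps ≡ suc m →
  ℤ.∣ coeff (crossPolytope m ps) (selectFacet choose m ps) ∣ ≡ 1
crossPolytope-facet choose zero ((a , b) ∷ []) (a<b , _) _ with choose a
... | true  rewrite dec-true (a ≟ⱽ a) refl | dec-false (b ≟ⱽ a) (<ᴸ⇒≢ a<b ∘ sym) = refl
... | false rewrite dec-true (b ≟ⱽ b) refl | dec-false (a ≟ⱽ b) (<ᴸ⇒≢ a<b)     = refl
crossPolytope-facet {r = r} choose (suc m) ((a , b) ∷ ps) (_ , inside , nested) len = step (choose a)
  where
  W = crossPolytope m ps
  F = selectFacet choose m ps
  len′ = ℕP.suc-injective len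
  IH : ℤ.∣ coeff W F ∣ ≡ 1
  IH = crossPolytope-facet choose m ps nested len′
  F-inside : ∀ i → Between r (a , b) (lookup F i)
  F-inside i = All.lookup inside (selectFacet-⊆ choose m ps len′ i)
  step : ∀ c → ℤ.∣ coeff (suspension (a , b) W) (if c then a ∷ F else F ∷ʳ b) ∣ ≡ 1
  step true = trans (cong ℤ.∣_∣ (coeff-suspension-∷ a b W F b≢last)) IH
    where
    b≢last : b ≢ last′ F
    b≢last b≡last with last′-lookup F
    ... | i , e = <ᴸ⇒≢ (before-b (F-inside i)) (sym (trans b≡last e))
  step false = begin
      ℤ.∣ coeff (suspension (a , b) W) (F ∷ʳ b) ∣
    ≡⟨ cong ℤ.∣_∣ (coeff-suspension-∷ʳ a b W F (<ᴸ⇒≢ (after-a (F-inside F.zero)))) ⟩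
      ℤ.∣ sign m * coeff W F ∣
    ≡⟨ ℤP.abs-* (sign m) (coeff W F) ⟩
      ℤ.∣ sign m ∣ ℕ.* ℤ.∣ coeff W F ∣
    ≡⟨ cong₂ ℕ._*_ (∣sign∣≡1 m) IH ⟩
      1
    ∎
    where open ≡-Reasoning

-- Maximal simplices and homology

Maximal : ∀ {n} (r : ℕ) {m} → Simplex n m → Set
Maximal {n} r F = ∀ (v : Vertex n) → (∀ j → hamming v (lookup F j) ≤ r) → ∃ λ j → lookup F j ≡ v

lookup-removeAt : ∀ {A : Set} {k} (σ : Vec A (suc k)) i j → lookup (removeAt σ i) j ≡ lookup σ (F.punchIn i j)
lookup-removeAt (x ∷ xs)     F.zero    j         = refl
lookup-removeAt (x ∷ y ∷ xs) (F.suc i) F.zero    = refl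
lookup-removeAt (x ∷ y ∷ xs) (F.suc i) (F.suc j) = lookup-removeAt (y ∷ xs) i j

Increasing-head : ∀ {n k} x (σ : Vec (Vertex n) (suc k)) → Increasing (x ∷ σ) → ∀ j → x <ᴸ lookup σ j
Increasing-head x (y ∷ σ)     (x<y , _)  F.zero    = x<y
Increasing-head x (y ∷ z ∷ σ) (x<y , σ↑) (F.suc j) = <ᴸ-trans x<y (Increasing-head y (z ∷ σ) σ↑ j)

Increasing-lookup-injective : ∀ {n k} (σ : Vec (Vertex n) k) → Increasing σ →
  ∀ i j → lookup σ i ≡ lookup σ j → i ≡ j
Increasing-lookup-injective (x ∷ σ)     _        F.zero    F.zero    _ = refl
Increasing-lookup-injective (x ∷ y ∷ σ) (_ , σ↑) (F.suc i) (F.suc j) e =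
  cong F.suc (Increasing-lookup-injective (y ∷ σ) σ↑ i j e)
Increasing-lookup-injective (x ∷ y ∷ σ) σ↑       F.zero    (F.suc j) e =
  ⊥-elim (<ᴸ⇒≢ (Increasing-head x (y ∷ σ) σ↑ j) e)
Increasing-lookup-injective (x ∷ y ∷ σ) σ↑       (F.suc i) F.zero    e =
  ⊥-elim (<ᴸ⇒≢ (Increasing-head x (y ∷ σ) σ↑ i) (sym e))

Maximal⇒¬face : ∀ {n r m} (F : Simplex n m) → Maximal r F → (σ : Simplex n (suc m)) →
  IsVRSimplex n r σ → ∀ i → removeAt σ i ≢ F
Maximal⇒¬face F max σ (σ↑ , dist) i σ∖i≡F
  with max (lookup σ i) (λ j → subst (λ v → hamming (lookup σ i) v ≤ _) (sym (F-lookup j)) (dist i (F.punchIn i j)))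
  where
  F-lookup : ∀ j → lookup F j ≡ lookup σ (F.punchIn i j)
  F-lookup j = trans (cong (λ τ → lookup τ j) (sym σ∖i≡F)) (lookup-removeAt σ i j)
... | j , e = FP.punchInᵢ≢i i j (Increasing-lookup-injective σ σ↑ _ _
                (trans (sym (lookup-removeAt σ i j)) (trans (cong (λ τ → lookup τ j) σ∖i≡F) e)))

coeff-∂-Maximal : ∀ {n r m} (F : Simplex n m) → Maximal r F → (w : Chain n (suc m)) → IsVRChain n r w →
  coeff (∂ w) F ≡ 0ℤ
coeff-∂-Maximal {n} {r} {m} F max w vr = coeff-≢ (∂ w) F (∂-avoids w vr)
  where
  ∂-avoids : (w : Chain n (suc m)) → IsVRChain n r w → All (λ e → proj₂ e ≢ F) (∂ w)
  ∂-avoids []            []          = []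
  ∂-avoids ((x , σ) ∷ w) (vrσ ∷ vrw) = subst (All _) (sym (∂-∷ x σ w))
    (AllP.++⁺ (VAllP.toList⁺ (VAllP.tabulate⁺ {f = λ i → (sign (toℕ i) * x , removeAt σ i)}
                                               (Maximal⇒¬face F max σ vrσ)))
              (∂-avoids w vrw))

coeff-concat-tabulate : ∀ {n m N} (G : Fin N → Chain n m) τ i → (∀ j → j ≢ i → coeff (G j) τ ≡ 0ℤ) →
  coeff (L.concat (L.tabulate G)) τ ≡ coeff (G i) τ
coeff-concat-tabulate {N = suc N} G τ F.zero others≡0 =
  trans (coeff-++ (G F.zero) _ τ)
        (trans (cong (coeff (G F.zero) τ +_) (all-zero (G ∘ F.suc) (λ j → others≡0 (F.suc j) λ ())))
               (ℤP.+-identityʳ _))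
  where
  all-zero : ∀ {N} (H : Fin N → Chain _ _) → (∀ j → coeff (H j) τ ≡ 0ℤ) → coeff (L.concat (L.tabulate H)) τ ≡ 0ℤ
  all-zero {zero}  H H≡0 = refl
  all-zero {suc N} H H≡0 = trans (coeff-++ (H F.zero) _ τ) (cong₂ _+_ (H≡0 F.zero) (all-zero (H ∘ F.suc) (H≡0 ∘ F.suc)))
coeff-concat-tabulate {N = suc N} G τ (F.suc i) others≡0 =
  trans (coeff-++ (G F.zero) _ τ)
        (trans (cong (_+ coeff (L.concat (L.tabulate (G ∘ F.suc))) τ) (others≡0 F.zero λ ()))
               (trans (ℤP.+-identityˡ _)
                      (coeff-concat-tabulate (G ∘ F.suc) τ i (λ j j≢i → others≡0 (F.suc j) (j≢i ∘ FP.suc-injective)))))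

-- A boundary has coefficient 0 on a maximal simplex, while Σ cⱼ zⱼ has coefficient ± cᵢ on Fᵢ.
rank-from-maximal-simplices : ∀ {n r m N} (z : Fin N → Chain n (suc m)) (F : Fin N → Simplex n (suc m)) →
  (∀ i → IsCycle n r (z i)) → (∀ i → Maximal r (F i)) →
  (∀ i → ℤ.∣ coeff (z i) (F i) ∣ ≡ 1) → (∀ i j → j ≢ i → coeff (z j) (F i) ≡ 0ℤ) →
  RankHomologyAtLeast n r m N
rank-from-maximal-simplices {n} {r} {m} {N} z F cycle max unit others = z , cycle , independent
  where
  independent : ∀ (c : Fin N → ℤ) → IsBoundary n r (linComb c z) → ∀ i → c i ≡ 0ℤ
  independent c (w , vr , ∂w≡) i = ℤP.∣i∣≡0⇒i≡0 (begin
      ℤ.∣ c i ∣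
    ≡⟨ sym (ℕP.*-identityʳ _) ⟩
      ℤ.∣ c i ∣ ℕ.* 1
    ≡⟨ cong (ℤ.∣ c i ∣ ℕ.*_) (sym (unit i)) ⟩
      ℤ.∣ c i ∣ ℕ.* ℤ.∣ coeff (z i) (F i) ∣
    ≡⟨ sym (ℤP.abs-* (c i) _) ⟩
      ℤ.∣ c i * coeff (z i) (F i) ∣
    ≡⟨ cong ℤ.∣_∣ (sym coeff-at-F) ⟩
      ℤ.∣ coeff (∂ w) (F i) ∣
    ≡⟨ cong ℤ.∣_∣ (coeff-∂-Maximal (F i) (max i) w vr) ⟩
      0
    ∎)
    where
    open ≡-Reasoning
    coeff-at-F : coeff (∂ w) (F i) ≡ c i * coeff (z i) (F i)
    coeff-at-F = begin
        coeff (∂ w) (F i)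
      ≡⟨ ∂w≡ (F i) ⟩
        coeff (linComb c z) (F i)
      ≡⟨ cong (λ l → coeff (L.concat l) (F i)) (LP.map-tabulate (λ j → j) (λ j → scale (c j) (z j))) ⟩
        coeff (L.concat (L.tabulate (λ j → scale (c j) (z j)))) (F i)
      ≡⟨ coeff-concat-tabulate (λ j → scale (c j) (z j)) (F i) i
           (λ j j≢i → trans (coeff-scale (c j) (z j) (F i)) (trans (cong (c j *_) (others i j j≢i)) (ℤP.*-zeroʳ (c j)))) ⟩
        coeff (scale (c i) (z i)) (F i)
      ≡⟨ coeff-scale (c i) (z i) (F i) ⟩
        c i * coeff (z i) (F i)
      ∎

-- Subcubes

data Subcube : ℕ → ℕ → Set where
  done : Subcube 0 0
  free : ∀ {n k} → Subcube n k → Subcube (suc n) (suc k)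
  fix  : ∀ {n k} → Bool → Subcube n k → Subcube (suc n) k

embed : ∀ {n k} → Subcube n k → Vertex k → Vertex n
embed done     []       = []
embed (free p) (x ∷ xs) = x ∷ embed p xs
embed (fix β p) xs      = β ∷ embed p xs

project : ∀ {n k} → Subcube n k → Vertex n → Vertex k
project done      []      = []
project (free p)  (x ∷ v) = x ∷ project p v
project (fix β p) (x ∷ v) = project p v

distanceTo : ∀ {n k} → Subcube n k → Vertex n → ℕ
distanceTo done      []      = 0
distanceTo (free p)  (x ∷ v) = distanceTo p v
distanceTo (fix β p) (x ∷ v) = (if does (x B.≟ β) then 0 else 1) ℕ.+ distanceTo p v

InSubcube : ∀ {n k} → Subcube n k → Vertex n → Set
InSubcube done      []      = ⊤
InSubcube (free p)  (x ∷ v) = InSubcube p v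
InSubcube (fix β p) (x ∷ v) = x ≡ β × InSubcube p v

InSubcube-embed : ∀ {n k} (p : Subcube n k) x → InSubcube p (embed p x)
InSubcube-embed done      []       = tt
InSubcube-embed (free p)  (x ∷ xs) = InSubcube-embed p xs
InSubcube-embed (fix β p) xs       = refl , InSubcube-embed p xs

project-embed : ∀ {n k} (p : Subcube n k) x → project p (embed p x) ≡ x
project-embed done      []       = refl
project-embed (free p)  (x ∷ xs) = cong (x ∷_) (project-embed p xs)
project-embed (fix β p) xs       = project-embed p xs

distanceTo≡0⇒embed-project : ∀ {n k} (p : Subcube n k) v → distanceTo p v ≡ 0 → embed p (project p v) ≡ v
distanceTo≡0⇒embed-project done      []      _ = refl
distanceTo≡0⇒embed-project (free p)  (x ∷ v) e = cong (x ∷_) (distanceTo≡0⇒embed-project p v e)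
distanceTo≡0⇒embed-project (fix β p) (x ∷ v) e with x B.≟ β
... | yes refl = cong (x ∷_) (distanceTo≡0⇒embed-project p v e)
... | no _     = ⊥-elim (ℕP.1+n≢0 e)

hamming-embed : ∀ {n k} (p : Subcube n k) v y → hamming v (embed p y) ≡ distanceTo p v ℕ.+ hamming (project p v) y
hamming-embed done []      [] = refl
hamming-embed (free p) (x ∷ v) (y ∷ ys) =
  trans (cong (differ ℕ.+_) (hamming-embed p v ys)) (x∙yz≈y∙xz differ (distanceTo p v) _)
  where differ = if does (x B.≟ y) then 0 else 1
hamming-embed (fix β p) (x ∷ v) ys =
  trans (cong ((if does (x B.≟ β) then 0 else 1) ℕ.+_) (hamming-embed p v ys))
        (sym (ℕP.+-assoc (if does (x B.≟ β) then 0 else 1) (distanceTo p v) _))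

hamming-embed-embed : ∀ {n k} (p : Subcube n k) x y → hamming (embed p x) (embed p y) ≡ hamming x y
hamming-embed-embed done      []       []       = refl
hamming-embed-embed (free p)  (x ∷ xs) (y ∷ ys) =
  cong ((if does (x B.≟ y) then 0 else 1) ℕ.+_) (hamming-embed-embed p xs ys)
hamming-embed-embed (fix false p) xs ys = hamming-embed-embed p xs ys
hamming-embed-embed (fix true p)  xs ys = hamming-embed-embed p xs ys

<ᴸ-embed : ∀ {n k} (p : Subcube n k) {x y} → x <ᴸ y → embed p x <ᴸ embed p y
<ᴸ-embed done      {[]}    {[]}    ()
<ᴸ-embed (free p)  {_ ∷ _} {_ ∷ _} (inj₁ (refl , refl)) = inj₁ (refl , refl)
<ᴸ-embed (free p)  {_ ∷ _} {_ ∷ _} (inj₂ (refl , x<y))  = inj₂ (refl , <ᴸ-embed p x<y)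
<ᴸ-embed (fix β p) x<y = inj₂ (refl , <ᴸ-embed p x<y)

subcubes : (n k : ℕ) → List (Subcube n k)
subcubes zero    zero    = done ∷ []
subcubes zero    (suc k) = []
subcubes (suc n) zero    = L.map (fix false) (subcubes n zero) ++ L.map (fix true) (subcubes n zero)
subcubes (suc n) (suc k) =
  L.map free (subcubes n k) ++ (L.map (fix false) (subcubes n (suc k)) ++ L.map (fix true) (subcubes n (suc k)))

length-map-fix : ∀ {n k} (ps : List (Subcube n k)) →
  L.length (L.map (fix false) ps ++ L.map (fix true) ps) ≡ L.length ps ℕ.+ L.length ps
length-map-fix ps =
  trans (LP.length-++ (L.map (fix false) ps)) (cong₂ ℕ._+_ (LP.length-map _ ps) (LP.length-map _ ps))

∸≡suc∸suc : ∀ {n k} → k < n → n ∸ k ≡ suc (n ∸ suc k)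
∸≡suc∸suc {suc n} {zero}  _         = refl
∸≡suc∸suc {suc n} {suc k} (s≤s k<n) = ∸≡suc∸suc k<n

double-count : ∀ n k →
  2 ^ (n ∸ suc k) ℕ.* (n C suc k) ℕ.+ 2 ^ (n ∸ suc k) ℕ.* (n C suc k) ≡ 2 ^ (n ∸ k) ℕ.* (n C suc k)
double-count n k with k ℕ.<? n
... | yes k<n rewrite ∸≡suc∸suc k<n =
  sym (trans (cong (λ y → (x ℕ.+ y) ℕ.* (n C suc k)) (ℕP.+-identityʳ x)) (ℕP.*-distribʳ-+ (n C suc k) x x))
  where x = 2 ^ (n ∸ suc k)
... | no  k≮n
  rewrite k>n⇒nCk≡0 (s≤s (ℕP.≮⇒≥ k≮n)) | ℕP.*-zeroʳ (2 ^ (n ∸ suc k)) | ℕP.*-zeroʳ (2 ^ (n ∸ k)) = refl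

length-subcubes : ∀ n k → L.length (subcubes n k) ≡ 2 ^ (n ∸ k) ℕ.* (n C k)
length-subcubes zero    zero    = refl
length-subcubes zero    (suc k) = refl
length-subcubes (suc n) zero    =
  trans (length-map-fix (subcubes n zero))
        (trans (cong (λ l → l ℕ.+ l) (trans (length-subcubes n zero) (ℕP.*-identityʳ (2 ^ n))))
               (sym (trans (ℕP.*-identityʳ (2 ^ suc n)) (cong (2 ^ n ℕ.+_) (ℕP.+-identityʳ (2 ^ n))))))
length-subcubes (suc n) (suc k) = begin
    L.length (L.map free (subcubes n k) ++ _)
  ≡⟨ LP.length-++ (L.map free (subcubes n k)) ⟩
    L.length (L.map free (subcubes n k)) ℕ.+ L.length (L.map (fix false) (subcubes n (suc k)) ++ _)
  ≡⟨ cong₂ ℕ._+_ (trans (LP.length-map free (subcubes n k)) (length-subcubes n k))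
                 (trans (length-map-fix (subcubes n (suc k))) (cong (λ l → l ℕ.+ l) (length-subcubes n (suc k)))) ⟩
    2 ^ (n ∸ k) ℕ.* (n C k) ℕ.+ (2 ^ (n ∸ suc k) ℕ.* (n C suc k) ℕ.+ 2 ^ (n ∸ suc k) ℕ.* (n C suc k))
  ≡⟨ cong (2 ^ (n ∸ k) ℕ.* (n C k) ℕ.+_) (double-count n k) ⟩
    2 ^ (n ∸ k) ℕ.* (n C k) ℕ.+ 2 ^ (n ∸ k) ℕ.* (n C suc k)
  ≡⟨ sym (ℕP.*-distribˡ-+ (2 ^ (n ∸ k)) (n C k) (n C suc k)) ⟩
    2 ^ (n ∸ k) ℕ.* (n C k ℕ.+ n C suc k)
  ≡⟨ cong (2 ^ (n ∸ k) ℕ.*_) (nCk+nC[k+1]≡[n+1]C[k+1] n k) ⟩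
    2 ^ (n ∸ k) ℕ.* (suc n C suc k)
  ∎
  where open ≡-Reasoning

disjoint-map : ∀ {A B C : Set} {f : A → C} {g : B → C} {xs ys} → (∀ x y → f x ≢ g y) →
  Disjoint (L.map f xs) (L.map g ys)
disjoint-map f≢g (v∈fxs , v∈gys) with ∈-map⁻ _ v∈fxs | ∈-map⁻ _ v∈gys
... | x , _ , refl | y , _ , e = f≢g x y e

Disjoint-++ : ∀ {A : Set} {xs ys zs : List A} → Disjoint xs ys → Disjoint xs zs → Disjoint xs (ys ++ zs)
Disjoint-++ {ys = ys} xs#ys xs#zs (v∈xs , v∈ys++zs) with ∈-++⁻ ys v∈ys++zs
... | inj₁ v∈ys = xs#ys (v∈xs , v∈ys)
... | inj₂ v∈zs = xs#zs (v∈xs , v∈zs)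

subcubes-unique : ∀ n k → Unique (subcubes n k)
subcubes-unique zero    zero    = [] ∷ []
subcubes-unique zero    (suc k) = []
subcubes-unique (suc n) zero    =
  UniqueP.++⁺ (UniqueP.map⁺ fix-injective (subcubes-unique n zero))
              (UniqueP.map⁺ fix-injective (subcubes-unique n zero)) (disjoint-map λ _ _ ())
  where
  fix-injective : ∀ {β n k} {p q : Subcube n k} → fix β p ≡ fix β q → p ≡ q
  fix-injective refl = refl
subcubes-unique (suc n) (suc k) =
  UniqueP.++⁺ (UniqueP.map⁺ free-injective (subcubes-unique n k))
    (UniqueP.++⁺ (UniqueP.map⁺ fix-injective (subcubes-unique n (suc k)))
                 (UniqueP.map⁺ fix-injective (subcubes-unique n (suc k))) (disjoint-map λ _ _ ()))
    (Disjoint-++ {ys = L.map (fix false) (subcubes n (suc k))} (disjoint-map λ _ _ ()) (disjoint-map λ _ _ ()))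
  where
  free-injective : ∀ {n k} {p q : Subcube n k} → free p ≡ free q → p ≡ q
  free-injective refl = refl
  fix-injective : ∀ {β n k} {p q : Subcube n k} → fix β p ≡ fix β q → p ≡ q
  fix-injective refl = refl

lookup-injective : ∀ {A : Set} {xs : List A} → Unique xs → ∀ i j → L.lookup xs i ≡ L.lookup xs j → i ≡ j
lookup-injective {xs = x ∷ xs} _          F.zero    F.zero    _ = refl
lookup-injective {xs = x ∷ xs} (x∉ ∷ _)   F.zero    (F.suc j) e = ⊥-elim (All.lookup x∉ (∈-lookup j) e)
lookup-injective {xs = x ∷ xs} (x∉ ∷ _)   (F.suc i) F.zero    e = ⊥-elim (All.lookup x∉ (∈-lookup i) (sym e))
lookup-injective {xs = x ∷ xs} (_ ∷ uniq) (F.suc i) (F.suc j) e = cong F.suc (lookup-injective uniq i j e)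

enumeration : ∀ {A : Set} (xs : List A) {N} → L.length xs ≡ N → Fin N → A
enumeration xs len i = L.lookup xs (F.cast (sym len) i)

enumeration-injective : ∀ {A : Set} {xs : List A} {N} (len : L.length xs ≡ N) → Unique xs →
  ∀ {i j} → enumeration xs len i ≡ enumeration xs len j → i ≡ j
enumeration-injective len uniq {i} {j} e =
  trans (sym (FP.cast-involutive len (sym len) i))
        (trans (cong (F.cast len) (lookup-injective uniq _ _ e)) (FP.cast-involutive len (sym len) j))

Spanning : ∀ k → (Vertex k → Set) → Set
Spanning k P = (∃ λ x → P x) × (∀ t β → ∃ λ x → P x × lookup x t ≡ β)

Spanning-tail : ∀ {k} {P : Vertex (suc k) → Set} → Spanning (suc k) P → Spanning k (λ y → ∃ λ b → P (b ∷ y))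
Spanning-tail {P = P} ((b ∷ y , Px) , spans) = (y , b , Px) , λ t β → tail (spans (F.suc t) β)
  where
  tail : ∀ {t β} → (∃ λ x → P x × lookup x (F.suc t) ≡ β) → ∃ λ y → (∃ λ b → P (b ∷ y)) × lookup y t ≡ β
  tail (b ∷ y , Px , e) = y , (b , Px) , e

not≢ : ∀ β → not β ≢ β
not≢ false ()
not≢ true  ()

escapes-smaller : ∀ {n k j} {P : Vertex k → Set} (p : Subcube n k) (q : Subcube n j) → j < k → Spanning k P →
  ∃ λ x → P x × ¬ InSubcube q (embed p x)
escapes-smaller done done () _
escapes-smaller (free p) (free q) (s≤s j<k) spanning with escapes-smaller p q j<k (Spanning-tail spanning)
... | y , (b , Px) , ∉q = b ∷ y , Px , ∉q
escapes-smaller (free p) (fix γ q) _ (_ , spans) with spans F.zero (not γ)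
... | x ∷ xs , Px , x≡¬γ = x ∷ xs , Px , λ (x≡γ , _) → not≢ γ (trans (sym x≡¬γ) x≡γ)
escapes-smaller (fix β p) (free q) (s≤s j<k) spanning = escapes-smaller p q (ℕP.m<n⇒m<1+n j<k) spanning
escapes-smaller (fix β p) (fix γ q) j<k spanning@((x , Px) , _) with β B.≟ γ
... | no β≢γ   = x , Px , λ (β≡γ , _) → β≢γ β≡γ
... | yes refl with escapes-smaller p q j<k spanning
... | x′ , Px′ , ∉q = x′ , Px′ , λ (_ , ∈q) → ∉q ∈q

escapes : ∀ {n k} {P : Vertex k → Set} (p q : Subcube n k) → p ≢ q → Spanning k P →
  ∃ λ x → P x × ¬ InSubcube q (embed p x)
escapes done done done≢done _ = ⊥-elim (done≢done refl)
escapes (free p) (free q) p≢q spanning with escapes p q (p≢q ∘ cong free) (Spanning-tail spanning)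
... | y , (b , Px) , ∉q = b ∷ y , Px , ∉q
escapes (free p) (fix γ q) _ (_ , spans) with spans F.zero (not γ)
... | x ∷ xs , Px , x≡¬γ = x ∷ xs , Px , λ (x≡γ , _) → not≢ γ (trans (sym x≡¬γ) x≡γ)
escapes (fix β p) (free q) _ spanning = escapes-smaller p q (ℕP.n<1+n _) spanning
escapes (fix β p) (fix γ q) p≢q spanning@((x , Px) , _) with β B.≟ γ
... | no β≢γ   = x , Px , λ (β≡γ , _) → β≢γ β≡γ
... | yes refl with escapes p q (p≢q ∘ cong (fix β)) spanning
... | x′ , Px′ , ∉q = x′ , Px′ , λ (_ , ∈q) → ∉q ∈q

-- Antipodal pairs of a subcube

cube : (k : ℕ) → List (Vertex k)
cube zero    = [] ∷ []
cube (suc k) = L.map (false ∷_) (cube k) ++ L.map (true ∷_) (cube k)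

length-cube : ∀ k → L.length (cube k) ≡ 2 ^ k
length-cube zero    = refl
length-cube (suc k) = trans (LP.length-++ (L.map (false ∷_) (cube k)))
  (cong₂ ℕ._+_ (trans (LP.length-map _ (cube k)) (length-cube k))
               (trans (LP.length-map _ (cube k)) (trans (length-cube k) (sym (ℕP.+-identityʳ _)))))

cube-sorted : ∀ k → AllPairs _<ᴸ_ (cube k)
cube-sorted zero    = [] ∷ []
cube-sorted (suc k) =
  AllPairsP.++⁺ (AllPairsP.map⁺ (AllPairs.map (λ x<y → inj₂ (refl , x<y)) (cube-sorted k)))
                (AllPairsP.map⁺ (AllPairs.map (λ x<y → inj₂ (refl , x<y)) (cube-sorted k)))
                (AllP.map⁺ (All.universal (λ _ → AllP.map⁺ (All.universal (λ _ → inj₁ (refl , refl)) (cube k))) (cube k)))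

cube-complete : ∀ {k} (x : Vertex k) → x ∈ cube k
cube-complete []          = here refl
cube-complete (false ∷ x) = ∈-++⁺ˡ (∈-map⁺ (false ∷_) (cube-complete x))
cube-complete (true ∷ x)  = ∈-++⁺ʳ (L.map (false ∷_) _) (∈-map⁺ (true ∷_) (cube-complete x))

antipodalPair : ∀ {n k} → Subcube n (suc k) → Vertex k → Pair n
antipodalPair p w = embed p (false ∷ w) , embed p (true ∷ complement w)

antipodalPairs : ∀ {n k} → Subcube n (suc k) → List (Pair n)
antipodalPairs {k = k} p = L.map (antipodalPair p) (cube k)

length-antipodalPairs : ∀ {n k} (p : Subcube n (suc k)) → L.length (antipodalPairs p) ≡ 2 ^ k
length-antipodalPairs {k = k} p = trans (LP.length-map (antipodalPair p) (cube k)) (length-cube k)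

-- Antipodal vertices of Q_(k+1) are at distance k + 1, any two other vertices at distance ≤ k.
Between-antipodalPair : ∀ {n k} (p : Subcube n (suc k)) {w u} → w <ᴸ u →
  Between k (antipodalPair p w) (embed p (false ∷ u)) × Between k (antipodalPair p w) (embed p (true ∷ complement u))
Between-antipodalPair {k = k} p {w} {u} w<u =
    between (<ᴸ-embed p (inj₂ (refl , w<u))) (<ᴸ-embed p (inj₁ (refl , refl)))
            (embedded (hamming-≤-dim w u))
            (embedded (subst (λ d → suc d ≤ k) (hamming-sym u (complement w))
                             (sum-with-pos (hamming-complement u w) (subst (1 ≤_) (hamming-sym w u) (<ᴸ⇒hamming-pos w<u)))))
  , between (<ᴸ-embed p (inj₁ (refl , refl))) (<ᴸ-embed p (inj₂ (refl , <ᴸ-complement w<u)))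
            (embedded (sum-with-pos (hamming-complement w u) (<ᴸ⇒hamming-pos w<u)))
            (embedded (subst (_≤ k) (sym (hamming-complement-both w u)) (hamming-≤-dim w u)))
  where
  embedded : ∀ {x y} → hamming x y ≤ k → hamming (embed p x) (embed p y) ≤ k
  embedded {x} {y} = subst (_≤ k) (sym (hamming-embed-embed p x y))
  sum-with-pos : ∀ {a b} → a ℕ.+ b ≡ k → 1 ≤ b → suc a ≤ k
  sum-with-pos {a} {b} a+b≡k 1≤b =
    subst (suc a ≤_) a+b≡k (subst (_≤ a ℕ.+ b) (ℕP.+-comm a 1) (ℕP.+-monoʳ-≤ a 1≤b))

antipodalPairs-nested : ∀ {n k} (p : Subcube n (suc k)) → Nested k (antipodalPairs p)
antipodalPairs-nested {k = k} p = nested (cube k) (cube-sorted k)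
  where
  later : ∀ w (us : List (Vertex k)) → All (w <ᴸ_) us →
    All (Between k (antipodalPair p w)) (vertices (L.map (antipodalPair p) us))
  later w []       []           = []
  later w (u ∷ us) (w<u ∷ w<us) =
    proj₁ (Between-antipodalPair p w<u) ∷ proj₂ (Between-antipodalPair p w<u) ∷ later w us w<us
  nested : ∀ (ws : List (Vertex k)) → AllPairs _<ᴸ_ ws → Nested k (L.map (antipodalPair p) ws)
  nested []       []            = tt
  nested (w ∷ ws) (w<ws ∷ sorted) = <ᴸ-embed p (inj₁ (refl , refl)) , later w ws w<ws , nested ws sorted

antipodalPairs-InSubcube : ∀ {n k} (p : Subcube n (suc k)) {v} → v ∈ vertices (antipodalPairs p) → InSubcube p v
antipodalPairs-InSubcube {k = k} p = go (cube k)
  where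
  go : ∀ (ws : List (Vertex k)) {v} → v ∈ vertices (L.map (antipodalPair p) ws) → InSubcube p v
  go (w ∷ ws) (here refl)         = InSubcube-embed p _
  go (w ∷ ws) (there (here refl)) = InSubcube-embed p _
  go (w ∷ ws) (there (there v∈))  = go ws v∈

-- even₃ differs on antipodal vertices of Q_(r+1) since 3 is odd; this is where r ≥ 2 is used.
even₃ : ∀ {k} → Vertex (3 ℕ.+ k) → Bool
even₃ (a ∷ b ∷ c ∷ _) = not (a xor (b xor c))

even₃-complement : ∀ {k} (x : Vertex (3 ℕ.+ k)) → even₃ (complement x) ≡ not (even₃ x)
even₃-complement (false ∷ false ∷ false ∷ _) = refl
even₃-complement (false ∷ false ∷ true  ∷ _) = refl
even₃-complement (false ∷ true  ∷ false ∷ _) = refl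
even₃-complement (false ∷ true  ∷ true  ∷ _) = refl
even₃-complement (true  ∷ false ∷ false ∷ _) = refl
even₃-complement (true  ∷ false ∷ true  ∷ _) = refl
even₃-complement (true  ∷ true  ∷ false ∷ _) = refl
even₃-complement (true  ∷ true  ∷ true  ∷ _) = refl

even₃-flip : ∀ {k} a (x : Vertex (2 ℕ.+ k)) → even₃ (not a ∷ x) ≡ not (even₃ (a ∷ x))
even₃-flip a (b ∷ c ∷ _) = cong not (sym (BP.not-distribˡ-xor a (b xor c)))

even₃-spanning : ∀ k → Spanning (3 ℕ.+ k) (λ x → even₃ x ≡ true)
even₃-spanning k = (zeros , refl) , spans
  where
  zeros = V.replicate (3 ℕ.+ k) false
  spans : ∀ t β → ∃ λ x → even₃ x ≡ true × lookup x t ≡ β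
  spans F.zero                    false = zeros , refl , refl
  spans F.zero                    true  = true ∷ true ∷ false ∷ V.replicate k false , refl , refl
  spans (F.suc F.zero)            false = zeros , refl , refl
  spans (F.suc F.zero)            true  = true ∷ true ∷ false ∷ V.replicate k false , refl , refl
  spans (F.suc (F.suc F.zero))    false = zeros , refl , refl
  spans (F.suc (F.suc F.zero))    true  = true ∷ false ∷ true ∷ V.replicate k false , refl , refl
  spans (F.suc (F.suc (F.suc t))) β     = false ∷ false ∷ false ∷ V.replicate k β , refl , VP.lookup-replicate t β

-- The witness is the complement of x, or that complement with its first coordinate flipped back.
far-even₃ : ∀ {r′} (x : Vertex (3 ℕ.+ r′)) → ∃ λ y → even₃ y ≡ true × 2 ℕ.+ r′ ≤ hamming x y
far-even₃ {r′} x with even₃ (complement x) in e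
... | true  = complement x , e , subst (2 ℕ.+ r′ ≤_) (sym (hamming-complement-self x)) (ℕP.n≤1+n _)
far-even₃ {r′} (a ∷ x) | false =
  not (not a) ∷ complement x , trans (even₃-flip (not a) (complement x)) (cong not e) , far a
  where
  far : ∀ a → 2 ℕ.+ r′ ≤ hamming (a ∷ x) (not (not a) ∷ complement x)
  far false = subst (2 ℕ.+ r′ ≤_) (sym (hamming-complement-self x)) ℕP.≤-refl
  far true  = subst (2 ℕ.+ r′ ≤_) (sym (hamming-complement-self x)) ℕP.≤-refl

module _ {n r′ : ℕ} (p : Subcube n (3 ℕ.+ r′)) where

  chooseEven₃ : Vertex n → Bool
  chooseEven₃ v = even₃ (project p v)

  subcubeFacet : (m : ℕ) → Simplex n m
  subcubeFacet m = selectFacet chooseEven₃ m (antipodalPairs p)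

  subcubeFacet-∋ : ∀ m → L.length (antipodalPairs p) ≡ suc m →
    ∀ y → even₃ y ≡ true → ∃ λ j → lookup (subcubeFacet m) j ≡ embed p y
  subcubeFacet-∋ m len (false ∷ w) even
    with selectFacet-pick chooseEven₃ m (antipodalPairs p) len (∈-map⁺ (antipodalPair p) (cube-complete w))
  ... | j , e = j , trans e (pick-first (trans (cong even₃ (project-embed p (false ∷ w))) even))
    where
    pick-first : chooseEven₃ (embed p (false ∷ w)) ≡ true → pick chooseEven₃ (antipodalPair p w) ≡ embed p (false ∷ w)
    pick-first chosen rewrite chosen = refl
  subcubeFacet-∋ m len (true ∷ u) even
    with selectFacet-pick chooseEven₃ m (antipodalPairs p) len (∈-map⁺ (antipodalPair p) (cube-complete (complement u)))
  ... | j , e = j , trans e (trans (pick-second not-chosen) (cong (λ x → embed p (true ∷ x)) (complement-involutive u)))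
    where
    not-chosen : chooseEven₃ (embed p (false ∷ complement u)) ≡ false
    not-chosen = trans (cong even₃ (project-embed p (false ∷ complement u)))
                       (trans (even₃-complement (true ∷ u)) (cong not even))
    pick-second : chooseEven₃ (embed p (false ∷ complement u)) ≡ false →
      pick chooseEven₃ (antipodalPair p (complement u)) ≡ embed p (true ∷ complement (complement u))
    pick-second rejected rewrite rejected = refl

  near-subcubeFacet⇒distanceTo≡0 : ∀ m → L.length (antipodalPairs p) ≡ suc m → ∀ v →
    (∀ j → hamming v (lookup (subcubeFacet m) j) ≤ 2 ℕ.+ r′) → distanceTo p v ≡ 0
  near-subcubeFacet⇒distanceTo≡0 m len v near-facet with far-even₃ (project p v)
  ... | y , even , far with subcubeFacet-∋ m len y even
  ... | j , e = ℕP.n≤0⇒n≡0 (ℕP.+-cancelʳ-≤ (hamming (project p v) y) (distanceTo p v) 0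
                  (ℕP.≤-trans (subst (_≤ 2 ℕ.+ r′) (trans (cong (hamming v) e) (hamming-embed p v y)) (near-facet j)) far))

  -- A vertex near the whole facet lies in the subcube; if it were not chosen, its antipode would be a
  -- facet vertex at distance r + 1.
  subcubeFacet-maximal : ∀ m → L.length (antipodalPairs p) ≡ suc m → Maximal (2 ℕ.+ r′) (subcubeFacet m)
  subcubeFacet-maximal m len v near-facet with even₃ (project p v) in chosen
  ... | true with subcubeFacet-∋ m len (project p v) chosen
  ... | j , e = j , trans e (distanceTo≡0⇒embed-project p v (near-subcubeFacet⇒distanceTo≡0 m len v near-facet))
  subcubeFacet-maximal m len v near-facet | false
    with subcubeFacet-∋ m len (complement (project p v)) (trans (even₃-complement (project p v)) (cong not chosen))
  ... | j , e = ⊥-elim (ℕP.<-irrefl refl (ℕP.≤-trans antipode-far (near-facet j)))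
    where
    open ≡-Reasoning
    antipode-far : 3 ℕ.+ r′ ≤ hamming v (lookup (subcubeFacet m) j)
    antipode-far = ℕP.≤-reflexive (sym (begin
        hamming v (lookup (subcubeFacet m) j)
      ≡⟨ cong (hamming v) e ⟩
        hamming v (embed p (complement (project p v)))
      ≡⟨ hamming-embed p v _ ⟩
        distanceTo p v ℕ.+ hamming (project p v) (complement (project p v))
      ≡⟨ cong₂ ℕ._+_ (near-subcubeFacet⇒distanceTo≡0 m len v near-facet) (hamming-complement-self (project p v)) ⟩
        3 ℕ.+ r′
      ∎))

subcubeCycle-vanishes : ∀ {n r′} (p q : Subcube n (3 ℕ.+ r′)) m → L.length (antipodalPairs p) ≡ suc m → p ≢ q →
  coeff (crossPolytope m (antipodalPairs q)) (subcubeFacet p m) ≡ 0ℤ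
subcubeCycle-vanishes {r′ = r′} p q m len p≢q with escapes p q p≢q (even₃-spanning r′)
... | x , even , ∉q with subcubeFacet-∋ p m len x even
... | j , e = coeff-≢ _ _ (All.map avoids (crossPolytope-SimplexOn m (antipodalPairs q) (antipodalPairs-nested q)))
  where
  avoids : ∀ {σ : Simplex _ m} → SimplexOn (2 ℕ.+ r′) (antipodalPairs q) σ → σ ≢ subcubeFacet p m
  avoids (_ , mem) refl = ∉q (subst (InSubcube q) e (antipodalPairs-InSubcube q (mem j)))

subcube-cycles-independent : ∀ r′ n →
  RankHomologyAtLeast n (2 ℕ.+ r′) (2 ^ (2 ℕ.+ r′) ∸ 2) (2 ^ (n ∸ (3 ℕ.+ r′)) ℕ.* (n C (3 ℕ.+ r′)))
subcube-cycles-independent r′ n = rank-from-maximal-simplices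
  (λ i → crossPolytope (suc K) (antipodalPairs (index i)))
  (λ i → subcubeFacet (index i) (suc K))
  (λ i → All.map proj₁ (crossPolytope-SimplexOn (suc K) _ (antipodalPairs-nested (index i)))
       , crossPolytope-cycle K (antipodalPairs (index i)))
  (λ i → subcubeFacet-maximal (index i) (suc K) (length-pairs (index i)))
  (λ i → crossPolytope-facet _ (suc K) _ (antipodalPairs-nested (index i)) (length-pairs (index i)))
  (λ i j j≢i → subcubeCycle-vanishes (index i) (index j) (suc K) (length-pairs (index i))
                 (j≢i ∘ sym ∘ index-injective))
  where
  K = 2 ^ (2 ℕ.+ r′) ∸ 2
  length-pairs : ∀ p → L.length (antipodalPairs p) ≡ suc (suc K)
  length-pairs p = trans (length-antipodalPairs p)
    (sym (trans (ℕP.+-comm 2 K) (ℕP.m∸n+n≡m (ℕP.*-monoʳ-≤ 2 (ℕP.m^n>0 2 (suc r′))))))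
  index : Fin (2 ^ (n ∸ (3 ℕ.+ r′)) ℕ.* (n C (3 ℕ.+ r′))) → Subcube n (3 ℕ.+ r′)
  index = enumeration (subcubes n (3 ℕ.+ r′)) (length-subcubes n (3 ℕ.+ r′))
  index-injective : ∀ {i j} → index i ≡ index j → i ≡ j
  index-injective = enumeration-injective (length-subcubes n (3 ℕ.+ r′)) (subcubes-unique n (3 ℕ.+ r′))

mainTheorem1 : (r n : ℕ) → 2 ≤ r → 1 ≤ n →
    RankHomologyAtLeast n r ((2 ^ r) ∸ 2) ((2 ^ (n ∸ (r ℕ.+ 1))) ℕ.* (n C (r ℕ.+ 1)))
mainTheorem1 (suc (suc r′)) n (s≤s (s≤s z≤n)) _ rewrite ℕP.+-comm r′ 1 = subcube-cycles-independent r′ n
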